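{- Let $\mathcal{A}=(A,I)$ be a countable $\{<\}$-structure, viewed as the directed graph $(A,E)$ with $E=I(<)$. Then $\mathcal{A}\preceq(\mathbb{Z},<)$ if and only if (H1) $\mathcal{A}$ contains no cycle, and (H2) for all $a,b\in A$ there is $c\in\mathbb{N}$ such that every path from $a$ to $b$ has length at most $c$.
   Context: A path is a finite sequence $(a_0,a_1,\dots,a_n)$ with $(a_{i-1},a_i)\in E$ for $1\le i\le n$; its length is $n$. A cycle is a sequence $(a_0,\dots,a_{k-1})$ with $k\ge1$ and $(a_i,a_{(i+1)\bmod k})\in E$ for $0\le i\le k-1$. $\mathcal{A}\preceq(\mathbb{Z},<)$ means there is a map $h:A\to\mathbb{Z}$ with $h(a)<h(b)$ whenever $(a,b)\in E$. -}

module Defs where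

open import Data.Nat using (ℕ; zero; suc; _≤_)
open import Data.Nat.DivMod using (_mod_)
open import Data.Fin using (Fin; toℕ; inject₁; fromℕ) renaming (zero to fzero; suc to fsuc)
open import Data.Integer using (ℤ) renaming (_<_ to _<ℤ_)
open import Data.Product using (Σ; ∃; _×_)
open import Relation.Binary.PropositionalEquality using (_≡_)
open import Relation.Nullary using (¬_)

Countable : Set → Set
Countable A = Σ (A → ℕ) λ f → ∀ x y → f x ≡ f y → x ≡ y

module _ {A : Set} (E : A → A → Set) where

  IsPath : (n : ℕ) → (Fin (suc n) → A) → Set
  IsPath n a = ∀ (i : Fin n) → E (a (inject₁ i)) (a (fsuc i))

  PathOfLength : A → A → ℕ → Set
  PathOfLength x y n = Σ (Fin (suc n) → A) λ a →
    IsPath n a × (a fzero ≡ x) × (a (fromℕ n) ≡ y)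

  IsCycle : (m : ℕ) → (Fin (suc m) → A) → Set
  IsCycle m a = ∀ (i : Fin (suc m)) → E (a i) (a ((suc (toℕ i)) mod (suc m)))

  NoCycle : Set
  NoCycle = ∀ (m : ℕ) (a : Fin (suc m) → A) → ¬ IsCycle m a

  BoundedPaths : Set
  BoundedPaths = ∀ (x y : A) → ∃ λ (c : ℕ) → ∀ (n : ℕ) → PathOfLength x y n → n ≤ c

  EmbedsIntoℤ : Set
  EmbedsIntoℤ = ∃ λ (h : A → ℤ) → ∀ (x y : A) → E x y → h x <ℤ h y

module Submission where

-- (⇒) Along a walk of length n from x to y a monotone h climbs by at least n,
--     so h x + n ≤ h y.  A cycle is a closed walk of positive length, which
--     is impossible, and n ≤ ∣ h y - h x ∣ bounds the paths from x to y.
-- (⇐) Bounded path lengths already exclude closed walks of positive length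
--     (going around one repeatedly gives arbitrarily long walks).  Using the
--     excluded middle, dist x y is the length of a longest walk from x to y.
--     Enumerating A by its injection into ℕ, we assign values point by point,
--     keeping the finite assignment consistent: whenever a walk of length n
--     runs from x to y, their values differ by at least n.  A new point z is
--     placed between the lower bounds hx + dist x z (x reaches z) and the
--     upper bounds hy - dist z y (z reaches y); these are compatible because
--     walks x → z → y are walks x → y.  The value of a is the one it receives
--     at its own stage, and consistency of later stages gives monotonicity.

open import Defs
open import Data.Sum using (_⊎_; inj₁; inj₂)
open import Data.Product using (_×_; _,_; Σ; ∃; proj₁; proj₂)
open import Relation.Nullary using (¬_; Dec)
open import Relation.Nullary.Decidable using (fromSum)
open import Function.Bundles using (_⇔_; mk⇔)
open import Data.Empty using (⊥-elim)
open import Data.Nat as ℕ using (ℕ; zero; suc; z≤n; s≤s; _⊔_; _≤′_; ≤′-refl; ≤′-step)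
import Data.Nat.Properties as ℕP
open import Data.Nat.DivMod using (_mod_; _%_; %-distribˡ-+; m%n%n≡m%n; n%n≡0)
open import Data.Integer as ℤ using (ℤ; +_; +≤+; _+_; _-_; _≤_; _<_; ∣_∣) renaming (suc to sucℤ)
import Data.Integer.Properties as ℤP
open import Data.Integer.Tactic.RingSolver using (solve-∀)
open import Data.Fin using (Fin; toℕ; fromℕ) renaming (zero to fzero; suc to fsuc)
open import Data.Fin.Properties using (toℕ-injective; toℕ-fromℕ<)
open import Data.List using (List; []; _∷_; map; filter)
open import Data.List.Membership.Propositional using (_∈_)
open import Data.List.Membership.Propositional.Properties using (∈-map∘filter⁺; ∈-map∘filter⁻)
open import Data.List.Relation.Unary.All using (lookup; tabulate)
open import Data.List.Relation.Unary.Any using (here; there)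
open import Data.List.Extrema ℤP.≤-totalOrder using (max; min; xs≤max; max≤v⁺; min≤xs)
open import Relation.Binary.PropositionalEquality

module Walks {A : Set} (E : A → A → Set) where

  -- Walks as an inductive family indexed by endpoints and length; they are
  -- interconvertible with the paths of Defs but compose more easily.
  data Walk : A → A → ℕ → Set where
    nil  : ∀ {x} → Walk x x 0
    cons : ∀ {x y z n} → E x y → Walk y z n → Walk x z (suc n)

  infixr 5 _++ʷ_
  _++ʷ_ : ∀ {x y z m n} → Walk x y m → Walk y z n → Walk x z (m ℕ.+ n)
  nil       ++ʷ w = w
  cons e v  ++ʷ w = cons e (v ++ʷ w)

  _▷_ : ∀ {x y z n} → Walk x y n → E y z → Walk x z (suc n)
  nil      ▷ e = cons e nil
  cons d w ▷ e = cons d (w ▷ e)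

  iterate : ∀ {x n} → Walk x x n → (k : ℕ) → Walk x x (k ℕ.* n)
  iterate w zero    = nil
  iterate w (suc k) = w ++ʷ iterate w k

  walk⇒path : ∀ {x y n} → Walk x y n → PathOfLength E x y n
  walk⇒path {x} nil = (λ _ → x) , (λ ()) , refl , refl
  walk⇒path {x} (cons {n = n} e w) with walk⇒path w
  ... | a , steps , refl , ends = vertex , edge , refl , ends
    where
    vertex : Fin (suc (suc n)) → A
    vertex fzero    = x
    vertex (fsuc i) = a i
    edge : IsPath E (suc n) vertex
    edge fzero    = e
    edge (fsuc i) = steps i

  path⇒walk : ∀ {x y n} → PathOfLength E x y n → Walk x y n
  path⇒walk {n = n} (a , steps , refl , refl) = along n a steps
    where
    along : ∀ n (a : Fin (suc n) → A) → IsPath E n a → Walk (a fzero) (a (fromℕ n)) n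
    along zero    a steps = nil
    along (suc n) a steps = cons (steps fzero) (along n (λ i → a (fsuc i)) (λ i → steps (fsuc i)))

  suc-mod : ∀ m k → suc (toℕ (k mod suc m)) mod suc m ≡ suc k mod suc m
  suc-mod m k = toℕ-injective (begin
      toℕ (suc (toℕ (k mod n)) mod n)  ≡⟨ toℕ-fromℕ< _ ⟩
      suc (toℕ (k mod n)) % n           ≡⟨ cong (λ r → suc r % n) (toℕ-fromℕ< _) ⟩
      (1 ℕ.+ k % n) % n                 ≡⟨ %-distribˡ-+ 1 (k % n) n ⟩
      (1 % n ℕ.+ k % n % n) % n         ≡⟨ cong (λ r → (1 % n ℕ.+ r) % n) (m%n%n≡m%n k n) ⟩
      (1 % n ℕ.+ k % n) % n             ≡⟨ %-distribˡ-+ 1 k n ⟨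
      suc k % n                         ≡⟨ toℕ-fromℕ< _ ⟨
      toℕ (suc k mod n)                 ∎)
    where
    n : ℕ
    n = suc m
    open ≡-Reasoning

  mod-self : ∀ m → suc m mod suc m ≡ 0 mod suc m
  mod-self m = toℕ-injective (trans (toℕ-fromℕ< _) (n%n≡0 (suc m)))

  cycle⇒closedWalk : ∀ {m a} → IsCycle E m a → ∃ λ x → Walk x x (suc m)
  cycle⇒closedWalk {m} {a} cyc =
    a (0 mod suc m) , subst (λ i → Walk (a (0 mod suc m)) (a i) (suc m)) (mod-self m) (around (suc m))
    where
    around : ∀ k → Walk (a (0 mod suc m)) (a (k mod suc m)) k
    around zero    = nil
    around (suc k) = around k ▷ subst (λ i → E (a (k mod suc m)) (a i)) (suc-mod m k) (cyc (k mod suc m))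

+suc≡suc+ : ∀ i n → i + + suc n ≡ sucℤ i + + n
+suc≡suc+ i n = trans (cong (λ k → i + k) (ℤP.pos-+ 1 n)) (shuffle i (+ n))
  where
  shuffle : ∀ i k → i + (ℤ.1ℤ + k) ≡ (ℤ.1ℤ + i) + k
  shuffle = solve-∀

<-gap : ∀ {i j k n} → i < j → j + + n ≤ k → i + + suc n ≤ k
<-gap {i} {n = n} i<j gap =
  ℤP.≤-trans (ℤP.≤-reflexive (+suc≡suc+ i n))
             (ℤP.≤-trans (ℤP.+-monoˡ-≤ (+ n) (ℤP.i<j⇒suc[i]≤j i<j)) gap)

no-positive-self-gap : ∀ {i n} → ¬ (i + + suc n ≤ i)
no-positive-self-gap {i} {n} gap = ℤP.<-irrefl refl (ℤP.suc[i]≤j⇒i<j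
  (ℤP.≤-trans (ℤP.i≤i+j (sucℤ i) (+ n)) (subst (_≤ i) (+suc≡suc+ i n) gap)))

gap-1⇒< : ∀ {i j} → i + + 1 ≤ j → i < j
gap-1⇒< {i} gap = ℤP.suc[i]≤j⇒i<j (subst (_≤ _) (ℤP.+-comm i (+ 1)) gap)

+-≤⇒≤- : ∀ {i j k} → i + k ≤ j → i ≤ j - k
+-≤⇒≤- {i} {j} {k} p = subst (_≤ j - k) (cancel i k) (ℤP.+-monoˡ-≤ (ℤ.- k) p)
  where
  cancel : ∀ i k → i + k - k ≡ i
  cancel = solve-∀

≤-⇒+-≤ : ∀ {i j k} → i ≤ j - k → i + k ≤ j
≤-⇒+-≤ {i} {j} {k} p = subst (i + k ≤_) (cancel j k) (ℤP.+-monoˡ-≤ k p)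
  where
  cancel : ∀ j k → j - k + k ≡ j
  cancel = solve-∀

split-gap : ∀ {i j} a b → i + + (a ℕ.+ b) ≤ j → i + + a ≤ j - + b
split-gap {i} {j} a b gap = +-≤⇒≤- (subst (_≤ j) regroup gap)
  where
  regroup : i + + (a ℕ.+ b) ≡ i + + a + + b
  regroup = trans (cong (λ k → i + k) (ℤP.pos-+ a b)) (sym (ℤP.+-assoc i (+ a) (+ b)))

gap-widen : ∀ i {m n} → m ℕ.≤ n → i + + m ≤ i + + n
gap-widen i m≤n = ℤP.+-monoʳ-≤ i (+≤+ m≤n)

gap≤∣-∣ : ∀ {i j n} → i + + n ≤ j → n ℕ.≤ ∣ j - i ∣
gap≤∣-∣ {i} {j} {n} gap = ℤP.drop‿+≤+ (subst (+ n ≤_) (sym (ℤP.0≤i⇒+∣i∣≡i 0≤j-i)) n≤j-i)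
  where
  n≤j-i : + n ≤ j - i
  n≤j-i = +-≤⇒≤- (subst (_≤ j) (ℤP.+-comm i (+ n)) gap)
  0≤j-i : + 0 ≤ j - i
  0≤j-i = ℤP.≤-trans (+≤+ z≤n) n≤j-i

module Monotone {A : Set} {E : A → A → Set}
                (h : A → ℤ) (h-mono : ∀ x y → E x y → h x < h y) where
  open Walks E

  climb : ∀ {x y n} → Walk x y n → h x + + n ≤ h y
  climb nil        = ℤP.≤-reflexive (ℤP.+-identityʳ _)
  climb (cons e w) = <-gap (h-mono _ _ e) (climb w)

  noCycle : NoCycle E
  noCycle m a cyc with cycle⇒closedWalk cyc
  ... | _ , w = no-positive-self-gap (climb w)

  boundedPaths : BoundedPaths E
  boundedPaths x y = ∣ h y - h x ∣ , λ n p → gap≤∣-∣ (climb (path⇒walk p))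

module Longest (LEM : ∀ (P : Set) → P ⊎ ¬ P) where

  -- The largest n ≤ c with P n, or 0 when there is none.
  longest : (ℕ → Set) → ℕ → ℕ
  longest P zero    = 0
  longest P (suc c) with LEM (P (suc c))
  ... | inj₁ _ = suc c
  ... | inj₂ _ = longest P c

  longest-spec : ∀ (P : ℕ → Set) c {n} → P n → n ℕ.≤ c → P (longest P c) × n ℕ.≤ longest P c
  longest-spec P zero    pn z≤n = pn , z≤n
  longest-spec P (suc c) pn n≤c with LEM (P (suc c))
  ... | inj₁ pc = pc , n≤c
  ... | inj₂ ¬pc with ℕP.m≤n⇒m<n∨m≡n n≤c
  ...   | inj₁ (s≤s n≤c′) = longest-spec P c pn n≤c′
  ...   | inj₂ refl       = ⊥-elim (¬pc pn)

between : List ℤ → List ℤ → ℤ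
between ls us = max (min (+ 0) us) ls

between-above : ∀ ls us {l} → l ∈ ls → l ≤ between ls us
between-above ls us = lookup (xs≤max (min (+ 0) us) ls)

between-below : ∀ ls us → (∀ {l u} → l ∈ ls → u ∈ us → l ≤ u) →
                ∀ {u} → u ∈ us → between ls us ≤ u
between-below ls us compatible u∈us =
  max≤v⁺ (lookup (min≤xs (+ 0) us) u∈us) (tabulate (λ l∈ls → compatible l∈ls u∈us))

module Construction (LEM : ∀ (P : Set) → P ⊎ ¬ P)
                    {A : Set} (E : A → A → Set) (bounded : BoundedPaths E) where
  open Walks E
  open Longest LEM

  length-bound : ∀ {x y n} → Walk x y n → n ℕ.≤ proj₁ (bounded x y)
  length-bound w = proj₂ (bounded _ _) _ (walk⇒path w)

  -- Closed walks are trivial: otherwise iterating one exceeds the bound.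
  closedWalk-trivial : ∀ {x n} → Walk x x n → n ≡ 0
  closedWalk-trivial {n = zero}  w = refl
  closedWalk-trivial {x} {suc n} w = ⊥-elim (ℕP.<-irrefl refl
      (ℕP.≤-trans (ℕP.m≤m*n (suc c) (suc n)) (length-bound (iterate w (suc c)))))
    where
    c : ℕ
    c = proj₁ (bounded x x)

  Reach : A → A → Set
  Reach x y = ∃ (Walk x y)

  -- The length of a longest walk from x to y (0 if there is none).
  dist : A → A → ℕ
  dist x y = longest (Walk x y) (proj₁ (bounded x y))

  dist-walk : ∀ {x y n} → Walk x y n → Walk x y (dist x y)
  dist-walk w = proj₁ (longest-spec _ _ w (length-bound w))

  dist-max : ∀ {x y n} → Walk x y n → n ℕ.≤ dist x y
  dist-max w = proj₂ (longest-spec _ _ w (length-bound w))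

  Consistent : List (A × ℤ) → Set
  Consistent L = ∀ {x hx y hy n} → (x , hx) ∈ L → (y , hy) ∈ L → Walk x y n → hx + + n ≤ hy

  reaches? : ∀ z (p : A × ℤ) → Dec (Reach (proj₁ p) z)
  reaches? z (x , _) = fromSum (LEM (Reach x z))

  reachedFrom? : ∀ z (p : A × ℤ) → Dec (Reach z (proj₁ p))
  reachedFrom? z (y , _) = fromSum (LEM (Reach z y))

  lowerBound upperBound : A → A × ℤ → ℤ
  lowerBound z (x , hx) = hx + + dist x z
  upperBound z (y , hy) = hy - + dist z y

  lows ups : A → List (A × ℤ) → List ℤ
  lows z L = map (lowerBound z) (filter (reaches? z) L)
  ups  z L = map (upperBound z) (filter (reachedFrom? z) L)

  -- Every lower bound is below every upper bound: a walk x → z → y is a walk x → y.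
  bounds-compatible : ∀ {z L} → Consistent L →
                      ∀ {l u} → l ∈ lows z L → u ∈ ups z L → l ≤ u
  bounds-compatible {z} consistent l∈ u∈
    with ∈-map∘filter⁻ (lowerBound z) (reaches? z) l∈
       | ∈-map∘filter⁻ (upperBound z) (reachedFrom? z) u∈
  ... | (x , hx) , x∈ , refl , (_ , x→z) | (y , hy) , y∈ , refl , (_ , z→y) =
    split-gap {hx} {hy} (dist x z) (dist z y) (consistent x∈ y∈ (dist-walk x→z ++ʷ dist-walk z→y))

  value : A → List (A × ℤ) → ℤ
  value z L = between (lows z L) (ups z L)

  extend : ∀ {z L} → Consistent L → Consistent ((z , value z L) ∷ L)
  extend {z} {L} consistent (here refl) (here refl) w
    rewrite closedWalk-trivial w = ℤP.≤-reflexive (ℤP.+-identityʳ _)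
  extend {z} {L} consistent {y = y} {hy} (here refl) (there y∈) w =
    ℤP.≤-trans (gap-widen (value z L) (dist-max w)) (≤-⇒+-≤ below)
    where
    below : value z L ≤ hy - + dist z y
    below = between-below (lows z L) (ups z L) (bounds-compatible consistent)
              (∈-map∘filter⁺ (upperBound z) (reachedFrom? z) ((y , hy) , y∈ , refl , (_ , w)))
  extend {z} {L} consistent {x} {hx} (there x∈) (here refl) w =
    ℤP.≤-trans (gap-widen hx (dist-max w))
      (between-above (lows z L) (ups z L)
        (∈-map∘filter⁺ (lowerBound z) (reaches? z) ((x , hx) , x∈ , refl , (_ , w))))
  extend consistent (there x∈) (there y∈) w = consistent x∈ y∈ w

  -- Stage k assigns values to the points with codes below k, in order.
  module Enumeration (code : A → ℕ) (code-inj : ∀ x y → code x ≡ code y → x ≡ y) where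

    decode : (k : ℕ) → (Σ A λ a → code a ≡ k) ⊎ ¬ (Σ A λ a → code a ≡ k)
    decode k = LEM (Σ A λ a → code a ≡ k)

    stage : ℕ → List (A × ℤ)
    stage zero = []
    stage (suc k) with decode k
    ... | inj₁ (a , _) = (a , value a (stage k)) ∷ stage k
    ... | inj₂ _       = stage k

    stage-consistent : ∀ k → Consistent (stage k)
    stage-consistent zero ()
    stage-consistent (suc k) with decode k
    ... | inj₁ _ = extend (stage-consistent k)
    ... | inj₂ _ = stage-consistent k

    stage-grows : ∀ {p k k′} → k ≤′ k′ → p ∈ stage k → p ∈ stage k′
    stage-grows ≤′-refl p∈ = p∈
    stage-grows {k′ = suc k′} (≤′-step k≤k′) p∈ with decode k′
    ... | inj₁ _ = there (stage-grows k≤k′ p∈)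
    ... | inj₂ _ = stage-grows k≤k′ p∈

    h : A → ℤ
    h a = value a (stage (code a))

    h-assigned : ∀ a → (a , h a) ∈ stage (suc (code a))
    h-assigned a with decode (code a)
    ... | inj₂ none = ⊥-elim (none (a , refl))
    ... | inj₁ (a′ , eq) with code-inj a′ a eq
    ...   | refl = here refl

    -- An edge is a walk of length one between two points assigned by a
    -- common (consistent) stage.
    h-mono : ∀ x y → E x y → h x < h y
    h-mono x y e = gap-1⇒< (stage-consistent K (assigned x (ℕP.m≤m⊔n (code x) (code y)))
                                                (assigned y (ℕP.m≤n⊔m (code x) (code y)))
                                                (cons e nil))
      where
      K : ℕ
      K = suc (code x ⊔ code y)
      assigned : ∀ a → code a ℕ.≤ code x ⊔ code y → (a , h a) ∈ stage K
      assigned a le = stage-grows (ℕP.≤⇒≤′ (s≤s le)) (h-assigned a)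

lemma6 : (LEM : ∀ (P : Set) → P ⊎ ¬ P) →
         (A : Set) (E : A → A → Set) → Countable A →
         EmbedsIntoℤ E ⇔ (NoCycle E × BoundedPaths E)
lemma6 LEM A E (code , code-inj) = mk⇔ forward backward
  where
  forward : EmbedsIntoℤ E → NoCycle E × BoundedPaths E
  forward (h , h-mono) = Monotone.noCycle h h-mono , Monotone.boundedPaths h h-mono

  backward : NoCycle E × BoundedPaths E → EmbedsIntoℤ E
  backward (_ , bounded) = h , h-mono
    where open Construction.Enumeration LEM E bounded code code-inj
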